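{- Let $1<p<q$ be relatively prime integers. If $n\ge q$, then $$\lfloor n/q\rfloor+\lfloor n/p\rfloor-2\lceil n/(pq)\rceil\le H^d(n,p,q)\le \lfloor n/q\rfloor+\lfloor (n-q)/p\rfloor+\lfloor (q-1)/p\rfloor-1.$$
   Context: A partial word is a sequence over $\Sigma\cup\{\diamondsuit\}$ with $\diamondsuit$ a hole. A partial word $S$ of length $n\ge\max(p,q)$ is $(p,q)$-special if there is a position $l$ such that for every position $i$: $S[i]=\mathsf a$ if $p\nmid(l-i)$ and $q\nmid(l-i)$; $S[i]=\mathsf b$ if $p\mid(l-i)$ and $q\mid(l-i)$; $S[i]=\diamondsuit$ otherwise ($\mathsf a\ne\mathsf b$ letters). $H^d(n,p,q)$ is the minimum number of holes in a $(p,q)$-special partial word of length $n$. -}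

module Defs where

open import Data.Nat using (ℕ; zero; suc; _+_; _∸_; _≤_; ∣_-_∣)
open import Data.Nat.DivMod using (_/_)
open import Data.Nat.Divisibility using (_∣_)
open import Data.Fin using (Fin; toℕ)
open import Data.List using (List; map; allFin)
open import Data.Nat.ListAction using (sum)
open import Data.Maybe using (Maybe; just; nothing)
open import Data.Product using (Σ; ∃; _×_)
open import Relation.Nullary using (¬_)
open import Relation.Binary.PropositionalEquality using (_≡_; _≢_)

-- floor(m / d) for d ≥ 1 (value at d = 0 is irrelevant, set to 0)
⌊_/_⌋ : ℕ → ℕ → ℕ
⌊ m / zero ⌋ = 0
⌊ m / suc k ⌋ = m / suc k

⌈_/_⌉ : ℕ → ℕ → ℕ
⌈ m / d ⌉ = ⌊ (m + (d ∸ 1)) / d ⌋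

-- A partial word of length n over alphabet A: positions 0..n-1,
-- a letter is  just x , a hole is  nothing .
PartialWord : Set → ℕ → Set
PartialWord A n = Fin n → Maybe A

holes : {A : Set} {n : ℕ} → PartialWord A n → ℕ
holes {n = n} S = sum (map (λ i → isHole (S i)) (allFin n))
  where
  isHole : {A : Set} → Maybe A → ℕ
  isHole nothing  = 1
  isHole (just _) = 0

-- The pattern required at position i relative to l, with letters a ≠ b.
-- Note: p ∣ (l - i) over ℤ iff p ∣ |l - i| over ℕ.
SpecialAt : {A : Set} {n : ℕ} → ℕ → ℕ → A → A → Fin n → PartialWord A n → Set
SpecialAt {n = n} p q a b l S =
  (i : Fin n) →
    ((¬ (p ∣ ∣ toℕ l - toℕ i ∣) × ¬ (q ∣ ∣ toℕ l - toℕ i ∣)) → S i ≡ just a)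
  × ((p ∣ ∣ toℕ l - toℕ i ∣ × q ∣ ∣ toℕ l - toℕ i ∣) → S i ≡ just b)
  × ((p ∣ ∣ toℕ l - toℕ i ∣ × ¬ (q ∣ ∣ toℕ l - toℕ i ∣)) → S i ≡ nothing)
  × ((¬ (p ∣ ∣ toℕ l - toℕ i ∣) × q ∣ ∣ toℕ l - toℕ i ∣) → S i ≡ nothing)

-- S is (p,q)-special (the length condition n ≥ max(p,q) is imposed separately)
Special : {A : Set} {n : ℕ} → ℕ → ℕ → PartialWord A n → Set
Special {A} {n} p q S =
  Σ A λ a → Σ A λ b → a ≢ b × Σ (Fin n) λ l → SpecialAt p q a b l S

IsHd : (A : Set) → ℕ → ℕ → ℕ → ℕ → Set
IsHd A n p q h =
  p ≤ n × q ≤ n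
  × (Σ (PartialWord A n) λ S → Special p q S × holes S ≡ h)
  × ((S : PartialWord A n) → Special p q S → h ≤ holes S)

-- A special word with centre l is forced at every position i by the distance
-- d = |l - i|: it has a hole iff exactly one of p, q divides d.  So all special
-- words with centre l have the same hole count holesAround p q n l, realised by a
-- canonical word, and H^d is the minimum of holesAround over the centres l < n.
--
-- Counting multiples of 1, …, N gives ⌊N/m⌋, hence the number of i < n with
-- m ∣ |l - i| is the closed form  ⌊l/m⌋ + 1 + ⌊(n-1-l)/m⌋  (multiplesNear), which
-- lies between ⌊n/m⌋ and ⌈n/m⌉.  Inclusion–exclusion together with
-- "p ∣ d and q ∣ d iff pq ∣ d" (coprimality) yields
--   holes + 2·multiplesNear(pq) = multiplesNear(p) + multiplesNear(q).
-- The lower bound follows at every centre from the floor/ceiling estimates; the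
-- upper bound follows by evaluating the identity at the centre l = q - 1.

module Submission where

open import Defs
open import Data.Nat
open import Data.Nat.Properties
open import Data.Nat.DivMod
open import Data.Nat.Divisibility
open import Data.Nat.Coprimality using (Coprime; coprime-divisor)
open import Data.Nat.Tactic.RingSolver using (solve-∀)
open import Data.Fin using (Fin; toℕ; fromℕ<) renaming (zero to fzero; suc to fsuc)
open import Data.Fin.Properties using (toℕ<n; toℕ-fromℕ<)
open import Data.List using (allFin)
open import Data.List.Properties using (map-tabulate)
open import Data.List.Relation.Unary.All using (lookup)
open import Data.List.Membership.Propositional.Properties using (∈-allFin)
open import Data.List.Extrema.Nat using (argmin; f[argmin]≤f[xs])
open import Data.Nat.ListAction using (sum)
open import Data.Maybe using (Maybe; just; nothing)
open import Data.Product using (Σ; _×_; _,_; proj₁; proj₂)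
open import Relation.Nullary using (Dec; yes; no; ¬_; contradiction)
open import Relation.Binary.PropositionalEquality
open import Function using (_∘_; id)

𝟙 : {P : Set} → Dec P → ℕ
𝟙 (yes _) = 1
𝟙 (no _)  = 0

𝟙-cong : {P Q : Set} (dp : Dec P) (dq : Dec Q) → (P → Q) → (Q → P) → 𝟙 dp ≡ 𝟙 dq
𝟙-cong (yes _) (yes _) _ _ = refl
𝟙-cong (yes p) (no ¬q) f _ = contradiction (f p) ¬q
𝟙-cong (no ¬p) (yes q) _ g = contradiction (g q) ¬p
𝟙-cong (no _)  (no _)  _ _ = refl

𝟙-yes : {P : Set} (d : Dec P) → P → 𝟙 d ≡ 1
𝟙-yes (yes _) _ = refl
𝟙-yes (no ¬p) p = contradiction p ¬p

𝟙-no : {P : Set} (d : Dec P) → ¬ P → 𝟙 d ≡ 0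
𝟙-no (yes p) ¬p = contradiction p ¬p
𝟙-no (no _)  _  = refl

𝟙[_∣_] : ℕ → ℕ → ℕ
𝟙[ m ∣ d ] = 𝟙 (m ∣? d)

sumBelow : ℕ → (ℕ → ℕ) → ℕ
sumBelow zero    f = 0
sumBelow (suc n) f = f 0 + sumBelow n (f ∘ suc)

syntax sumBelow n (λ i → e) = ∑[ i < n ] e

sum-cong : ∀ n {f g : ℕ → ℕ} → (∀ i → f i ≡ g i) → sumBelow n f ≡ sumBelow n g
sum-cong zero    eq = refl
sum-cong (suc n) eq = cong₂ _+_ (eq 0) (sum-cong n (eq ∘ suc))

sum-zero : ∀ n (f : ℕ → ℕ) → (∀ i → i < n → f i ≡ 0) → sumBelow n f ≡ 0
sum-zero zero    f vanish = refl
sum-zero (suc n) f vanish =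
  cong₂ _+_ (vanish 0 z<s) (sum-zero n (f ∘ suc) (λ i i<n → vanish (suc i) (s<s i<n)))

sum-+ : ∀ n (f g : ℕ → ℕ) → ∑[ i < n ] (f i + g i) ≡ sumBelow n f + sumBelow n g
sum-+ zero    f g = refl
sum-+ (suc n) f g = begin
  (f 0 + g 0) + ∑[ i < n ] (f (suc i) + g (suc i))
    ≡⟨ cong ((f 0 + g 0) +_) (sum-+ n (f ∘ suc) (g ∘ suc)) ⟩
  (f 0 + g 0) + (sumBelow n (f ∘ suc) + sumBelow n (g ∘ suc))
    ≡⟨ +-exchange (f 0) (g 0) _ _ ⟩
  (f 0 + sumBelow n (f ∘ suc)) + (g 0 + sumBelow n (g ∘ suc)) ∎
  where
  open ≡-Reasoning
  +-exchange : ∀ a b c d → (a + b) + (c + d) ≡ (a + c) + (b + d)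
  +-exchange = solve-∀

sum-* : ∀ n k (f : ℕ → ℕ) → ∑[ i < n ] (k * f i) ≡ k * sumBelow n f
sum-* zero    k f = sym (*-zeroʳ k)
sum-* (suc n) k f =
  trans (cong (k * f 0 +_) (sum-* n k (f ∘ suc))) (sym (*-distribˡ-+ k (f 0) _))

sum-split : ∀ m n (f : ℕ → ℕ) → sumBelow (m + n) f ≡ sumBelow m f + ∑[ i < n ] f (m + i)
sum-split zero    n f = refl
sum-split (suc m) n f = trans (cong (f 0 +_) (sum-split m n (f ∘ suc))) (sym (+-assoc (f 0) _ _))

sum-snoc : ∀ n (f : ℕ → ℕ) → sumBelow (suc n) f ≡ sumBelow n f + f n
sum-snoc zero    f = +-comm (f 0) 0
sum-snoc (suc n) f = trans (cong (f 0 +_) (sum-snoc n (f ∘ suc))) (sym (+-assoc (f 0) _ _))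

𝟙∣-periodic : ∀ m d → 𝟙[ m ∣ m + d ] ≡ 𝟙[ m ∣ d ]
𝟙∣-periodic m d = 𝟙-cong (m ∣? m + d) (m ∣? d) (λ m∣m+d → ∣m+n∣m⇒∣n m∣m+d ∣-refl) (∣m∣n⇒∣m+n ∣-refl)

no-multiples-below : ∀ m r → r < m → ∑[ d < r ] 𝟙[ m ∣ suc d ] ≡ 0
no-multiples-below m r r<m = sum-zero r _ λ d d<r →
  𝟙-no (m ∣? suc d) (λ m∣1+d → <⇒≱ (≤-<-trans d<r r<m) (∣⇒≤ m∣1+d))

one-multiple-per-period : ∀ m → .{{_ : NonZero m}} → ∑[ d < m ] 𝟙[ m ∣ suc d ] ≡ 1
one-multiple-per-period (suc k) = begin
  ∑[ d < suc k ] 𝟙[ suc k ∣ suc d ]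
    ≡⟨ sum-snoc k _ ⟩
  ∑[ d < k ] 𝟙[ suc k ∣ suc d ] + 𝟙[ suc k ∣ suc k ]
    ≡⟨ cong₂ _+_ (no-multiples-below (suc k) k ≤-refl) (𝟙-yes (suc k ∣? suc k) ∣-refl) ⟩
  1 ∎
  where open ≡-Reasoning

multiples-periods : ∀ m → .{{_ : NonZero m}} → ∀ a r →
  ∑[ d < a * m + r ] 𝟙[ m ∣ suc d ] ≡ a + ∑[ d < r ] 𝟙[ m ∣ suc d ]
multiples-periods m zero    r = refl
multiples-periods m (suc a) r = begin
  sumBelow (m + a * m + r) count              ≡⟨ cong (λ k → sumBelow k count) (+-assoc m (a * m) r) ⟩
  sumBelow (m + (a * m + r)) count            ≡⟨ sum-split m (a * m + r) count ⟩
  sumBelow m count + ∑[ d < a * m + r ] count (m + d)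
    ≡⟨ cong₂ _+_ (one-multiple-per-period m) (sum-cong (a * m + r) shift) ⟩
  1 + sumBelow (a * m + r) count              ≡⟨ cong suc (multiples-periods m a r) ⟩
  suc a + sumBelow r count ∎
  where
  open ≡-Reasoning
  count : ℕ → ℕ
  count d = 𝟙[ m ∣ suc d ]
  shift : ∀ d → count (m + d) ≡ count d
  shift d = trans (cong 𝟙[ m ∣_] (sym (+-suc m d))) (𝟙∣-periodic m (suc d))

multiples-upTo : ∀ m → .{{_ : NonZero m}} → ∀ N → ∑[ d < N ] 𝟙[ m ∣ suc d ] ≡ N / m
multiples-upTo m N = begin
  sumBelow N count                            ≡⟨ cong (λ k → sumBelow k count) N≡ ⟩
  sumBelow (N / m * m + N % m) count          ≡⟨ multiples-periods m (N / m) (N % m) ⟩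
  N / m + sumBelow (N % m) count              ≡⟨ cong (N / m +_) (no-multiples-below m (N % m) (m%n<n N m)) ⟩
  N / m + 0                                   ≡⟨ +-identityʳ (N / m) ⟩
  N / m ∎
  where
  open ≡-Reasoning
  count : ℕ → ℕ
  count d = 𝟙[ m ∣ suc d ]
  N≡ : N ≡ N / m * m + N % m
  N≡ = trans (m≡m%n+[m/n]*n N m) (+-comm (N % m) _)

cut-at : ∀ {l n} → l < n → l + suc (n ∸ suc l) ≡ n
cut-at {l} {n} l<n = trans (+-suc l (n ∸ suc l)) (m+[n∸m]≡n l<n)

sum-left-of : ∀ (g : ℕ → ℕ) l → ∑[ i < l ] g ∣ l - i ∣ ≡ sumBelow l (g ∘ suc)
sum-left-of g zero    = refl
sum-left-of g (suc l) = begin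
  g (suc l) + ∑[ i < l ] g ∣ l - i ∣     ≡⟨ cong (g (suc l) +_) (sum-left-of g l) ⟩
  g (suc l) + sumBelow l (g ∘ suc)       ≡⟨ +-comm (g (suc l)) _ ⟩
  sumBelow l (g ∘ suc) + g (suc l)       ≡⟨ sum-snoc l (g ∘ suc) ⟨
  sumBelow (suc l) (g ∘ suc) ∎
  where open ≡-Reasoning

sum-around : ∀ (g : ℕ → ℕ) {l n} → l < n →
  ∑[ i < n ] g ∣ l - i ∣ ≡ sumBelow l (g ∘ suc) + g 0 + sumBelow (n ∸ suc l) (g ∘ suc)
sum-around g {l} {n} l<n = begin
  sumBelow n G                                      ≡⟨ cong (λ k → sumBelow k G) (cut-at l<n) ⟨
  sumBelow (l + suc t) G                            ≡⟨ sum-split l (suc t) G ⟩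
  sumBelow l G + ∑[ j < suc t ] g ∣ l - l + j ∣
    ≡⟨ cong₂ _+_ (sum-left-of g l) (sum-cong (suc t) (cong g ∘ ∣m-m+n∣≡n l)) ⟩
  sumBelow l (g ∘ suc) + (g 0 + sumBelow t (g ∘ suc))
    ≡⟨ +-assoc (sumBelow l (g ∘ suc)) (g 0) _ ⟨
  sumBelow l (g ∘ suc) + g 0 + sumBelow t (g ∘ suc) ∎
  where
  open ≡-Reasoning
  t = n ∸ suc l
  G : ℕ → ℕ
  G i = g ∣ l - i ∣

-- The closed form  ⌊l/m⌋ + 1 + ⌊(n-1-l)/m⌋  of the number of positions i < n whose
-- distance to l is a multiple of m (see multiples-around).
multiplesNear : ∀ m → .{{_ : NonZero m}} → ℕ → ℕ → ℕ
multiplesNear m n l = l / m + 1 + (n ∸ suc l) / m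

multiples-around : ∀ m → .{{_ : NonZero m}} → ∀ {l n} → l < n →
  ∑[ i < n ] 𝟙[ m ∣ ∣ l - i ∣ ] ≡ multiplesNear m n l
multiples-around m {l} {n} l<n = begin
  ∑[ i < n ] 𝟙[ m ∣ ∣ l - i ∣ ]
    ≡⟨ sum-around 𝟙[ m ∣_] l<n ⟩
  ∑[ d < l ] 𝟙[ m ∣ suc d ] + 𝟙[ m ∣ 0 ] + ∑[ d < n ∸ suc l ] 𝟙[ m ∣ suc d ]
    ≡⟨ cong₂ _+_ (cong₂ _+_ (multiples-upTo m l) (𝟙-yes (m ∣? 0) (m ∣0))) (multiples-upTo m (n ∸ suc l)) ⟩
  multiplesNear m n l ∎
  where open ≡-Reasoning

div-shift : ∀ m → .{{_ : NonZero m}} → ∀ x k → (x + k * m) / m ≡ x / m + k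
div-shift m x k = trans (+-distrib-/-∣ʳ x (n∣m*n k)) (cong (x / m +_) (m*n/n≡m k m))

sum-by-remainders : ∀ m → .{{_ : NonZero m}} → ∀ a b →
  a + b ≡ (a % m + b % m) + (a / m + b / m) * m
sum-by-remainders m a b = begin
  a + b                                             ≡⟨ cong₂ _+_ (m≡m%n+[m/n]*n a m) (m≡m%n+[m/n]*n b m) ⟩
  (a % m + a / m * m) + (b % m + b / m * m)         ≡⟨ regroup (a % m) (b % m) (a / m) (b / m) m ⟩
  (a % m + b % m) + (a / m + b / m) * m ∎
  where
  open ≡-Reasoning
  regroup : ∀ x y u v m → (x + u * m) + (y + v * m) ≡ (x + y) + (u + v) * m
  regroup = solve-∀

div-+-lower : ∀ m → .{{_ : NonZero m}} → ∀ a b → a / m + b / m ≤ (a + b) / m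
div-+-lower m a b = begin
  a / m + b / m                                     ≤⟨ m≤n+m (a / m + b / m) ((a % m + b % m) / m) ⟩
  (a % m + b % m) / m + (a / m + b / m)             ≡⟨ div-shift m (a % m + b % m) (a / m + b / m) ⟨
  ((a % m + b % m) + (a / m + b / m) * m) / m       ≡⟨ /-congˡ (sum-by-remainders m a b) ⟨
  (a + b) / m ∎
  where open ≤-Reasoning

-- ⌊(a+b+1)/m⌋ ≤ ⌊a/m⌋ + 1 + ⌊b/m⌋, since the two remainders plus one stay below 2m.
div-+-upper : ∀ m → .{{_ : NonZero m}} → ∀ a b → (a + suc b) / m ≤ a / m + 1 + b / m
div-+-upper m a b = begin
  (a + suc b) / m                                   ≡⟨ /-congˡ (trans (+-suc a b) (cong suc (sum-by-remainders m a b))) ⟩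
  (suc (a % m + b % m) + (a / m + b / m) * m) / m   ≡⟨ div-shift m (suc (a % m + b % m)) (a / m + b / m) ⟩
  suc (a % m + b % m) / m + (a / m + b / m)         ≤⟨ +-monoˡ-≤ (a / m + b / m) (<⇒≤pred (m<n*o⇒m/o<n {n = 2} remainders<2m)) ⟩
  1 + (a / m + b / m)                               ≡⟨ move-one (a / m) (b / m) ⟩
  a / m + 1 + b / m ∎
  where
  open ≤-Reasoning
  remainders<2m : suc (a % m + b % m) < 2 * m
  remainders<2m = begin-strict
    suc (a % m) + b % m                             <⟨ +-mono-≤-< (m%n<n a m) (m%n<n b m) ⟩
    m + m                                           ≡⟨ cong (m +_) (+-identityʳ m) ⟨
    2 * m ∎
  move-one : ∀ x y → 1 + (x + y) ≡ x + 1 + y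
  move-one = solve-∀

floor≤multiplesNear : ∀ m → .{{_ : NonZero m}} → ∀ {l n} → l < n → ⌊ n / m ⌋ ≤ multiplesNear m n l
floor≤multiplesNear m@(suc _) {l} {n} l<n =
  subst (λ k → k / m ≤ multiplesNear m n l) (cut-at l<n) (div-+-upper m l (n ∸ suc l))

multiplesNear≤ceil : ∀ m → .{{_ : NonZero m}} → ∀ {l n} → l < n → multiplesNear m n l ≤ ⌈ n / m ⌉
multiplesNear≤ceil m@(suc k) {l} {n} l<n = begin
  l / m + 1 + t / m          ≡⟨ move-one (l / m) (t / m) ⟩
  l / m + t / m + 1          ≤⟨ +-monoˡ-≤ 1 (div-+-lower m l t) ⟩
  (l + t) / m + 1            ≡⟨ div-shift m (l + t) 1 ⟨
  (l + t + 1 * m) / m        ≡⟨ /-congˡ (trans (regroup l t k) (cong (_+ k) (cut-at l<n))) ⟩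
  (n + k) / m ∎
  where
  open ≤-Reasoning
  t = n ∸ suc l
  move-one : ∀ x y → x + 1 + y ≡ x + y + 1
  move-one = solve-∀
  regroup : ∀ l t k → l + t + 1 * suc k ≡ l + suc t + k
  regroup = solve-∀

-- The letter a special word must carry at a position, given whether p and q
-- divide its distance to the centre (propositions P and Q); this is exactly one
-- component of SpecialAt.
Pattern : {A : Set} (P Q : Set) → A → A → Maybe A → Set
Pattern P Q a b x =
    ((¬ P × ¬ Q) → x ≡ just a) × ((P × Q) → x ≡ just b)
  × ((P × ¬ Q) → x ≡ nothing) × ((¬ P × Q) → x ≡ nothing)

patternLetter : {A P Q : Set} → A → A → Dec P → Dec Q → Maybe A
patternLetter a b (yes _) (yes _) = just b
patternLetter a b (no _)  (no _)  = just a
patternLetter a b (yes _) (no _)  = nothing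
patternLetter a b (no _)  (yes _) = nothing

patternLetter-pattern : {A P Q : Set} (a b : A) (dp : Dec P) (dq : Dec Q) →
  Pattern P Q a b (patternLetter a b dp dq)
patternLetter-pattern a b (yes p) (yes q) =
  (λ (¬p , _) → contradiction p ¬p) , (λ _ → refl) , (λ (_ , ¬q) → contradiction q ¬q) , (λ (¬p , _) → contradiction p ¬p)
patternLetter-pattern a b (yes p) (no ¬q) =
  (λ (¬p , _) → contradiction p ¬p) , (λ (_ , q) → contradiction q ¬q) , (λ _ → refl) , (λ (¬p , _) → contradiction p ¬p)
patternLetter-pattern a b (no ¬p) (yes q) =
  (λ (_ , ¬q) → contradiction q ¬q) , (λ (p , _) → contradiction p ¬p) , (λ (p , _) → contradiction p ¬p) , (λ _ → refl)
patternLetter-pattern a b (no ¬p) (no ¬q) =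
  (λ _ → refl) , (λ (p , _) → contradiction p ¬p) , (λ (p , _) → contradiction p ¬p) , (λ (_ , q) → contradiction q ¬q)

holeCount : {A : Set} → Maybe A → ℕ
holeCount nothing  = 1
holeCount (just _) = 0

exactlyOne : {P Q : Set} → Dec P → Dec Q → ℕ
exactlyOne (yes _) (yes _) = 0
exactlyOne (no _)  (no _)  = 0
exactlyOne (yes _) (no _)  = 1
exactlyOne (no _)  (yes _) = 1

pattern-holeCount : {A P Q : Set} {a b : A} {x : Maybe A} (dp : Dec P) (dq : Dec Q) →
  Pattern P Q a b x → holeCount x ≡ exactlyOne dp dq
pattern-holeCount (yes p) (yes q) (_ , both , _ , _)     = cong holeCount (both (p , q))
pattern-holeCount (yes p) (no ¬q) (_ , _ , onlyP , _)    = cong holeCount (onlyP (p , ¬q))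
pattern-holeCount (no ¬p) (yes q) (_ , _ , _ , onlyQ)    = cong holeCount (onlyQ (¬p , q))
pattern-holeCount (no ¬p) (no ¬q) (neither , _ , _ , _)  = cong holeCount (neither (¬p , ¬q))

exactlyOne-inclusion-exclusion : {P Q : Set} (dp : Dec P) (dq : Dec Q) →
  exactlyOne dp dq + 2 * (𝟙 dp * 𝟙 dq) ≡ 𝟙 dp + 𝟙 dq
exactlyOne-inclusion-exclusion (yes _) (yes _) = refl
exactlyOne-inclusion-exclusion (yes _) (no _)  = refl
exactlyOne-inclusion-exclusion (no _)  (yes _) = refl
exactlyOne-inclusion-exclusion (no _)  (no _)  = refl

-- Peeling off the first position of a partial word.  The hole indicator used by
-- holes is local to its definition, so we case on the first letter instead.
holes-suc : {A : Set} {n : ℕ} (S : PartialWord A (suc n)) →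
  holes S ≡ holeCount (S fzero) + holes (S ∘ fsuc)
holes-suc {n = n} S with S fzero
... | nothing = cong suc (cong sum (trans (map-tabulate {n = n} fsuc _) (sym (map-tabulate {n = n} id _))))
... | just _  = cong sum (trans (map-tabulate {n = n} fsuc _) (sym (map-tabulate {n = n} id _)))

holes-pointwise : {A : Set} {n : ℕ} (S : PartialWord A n) (c : ℕ → ℕ) →
  (∀ i → holeCount (S i) ≡ c (toℕ i)) → holes S ≡ sumBelow n c
holes-pointwise {n = zero}  S c eq = refl
holes-pointwise {n = suc n} S c eq =
  trans (holes-suc S) (cong₂ _+_ (eq fzero) (holes-pointwise (S ∘ fsuc) (c ∘ suc) (eq ∘ fsuc)))

holeAt : ℕ → ℕ → ℕ → ℕ
holeAt p q d = exactlyOne (p ∣? d) (q ∣? d)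

holesAround : ℕ → ℕ → ℕ → ℕ → ℕ
holesAround p q n l = ∑[ i < n ] holeAt p q ∣ l - i ∣

special-holes : {A : Set} {n : ℕ} (p q : ℕ) {a b : A} (l : Fin n) (S : PartialWord A n) →
  SpecialAt p q a b l S → holes S ≡ holesAround p q n (toℕ l)
special-holes p q l S special = holes-pointwise S _ λ i →
  pattern-holeCount (p ∣? ∣ toℕ l - toℕ i ∣) (q ∣? ∣ toℕ l - toℕ i ∣) (special i)

canonicalWord : {A : Set} {n : ℕ} → ℕ → ℕ → A → A → Fin n → PartialWord A n
canonicalWord p q a b l i = patternLetter a b (p ∣? ∣ toℕ l - toℕ i ∣) (q ∣? ∣ toℕ l - toℕ i ∣)

canonicalWord-special : {A : Set} {n : ℕ} (p q : ℕ) (a b : A) (l : Fin n) →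
  SpecialAt p q a b l (canonicalWord p q a b l)
canonicalWord-special p q a b l i =
  patternLetter-pattern a b (p ∣? ∣ toℕ l - toℕ i ∣) (q ∣? ∣ toℕ l - toℕ i ∣)

coprime-product-∣ : ∀ {p q d} → Coprime p q → p ∣ d → q ∣ d → p * q ∣ d
coprime-product-∣ {p} {q} cop p∣d (divides-refl k) =
  *-monoˡ-∣ q (coprime-divisor cop (subst (p ∣_) (*-comm k q) p∣d))

𝟙-coprime-product : ∀ {p q} → Coprime p q → ∀ d → 𝟙 (p ∣? d) * 𝟙 (q ∣? d) ≡ 𝟙[ p * q ∣ d ]
𝟙-coprime-product {p} {q} cop d with p ∣? d | q ∣? d
... | yes p∣d | yes q∣d = sym (𝟙-yes (p * q ∣? d) (coprime-product-∣ cop p∣d q∣d))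
... | yes _   | no ¬q∣d = sym (𝟙-no (p * q ∣? d) (¬q∣d ∘ m*n∣⇒n∣ p q))
... | no ¬p∣d | _       = sym (𝟙-no (p * q ∣? d) (¬p∣d ∘ m*n∣⇒m∣ p q))

holesAround-identity : ∀ p q → .{{_ : NonZero p}} .{{_ : NonZero q}} → Coprime p q → ∀ {l n} → l < n →
  holesAround p q n l + 2 * multiplesNear (p * q) {{m*n≢0 p q}} n l ≡ multiplesNear p n l + multiplesNear q n l
holesAround-identity p q cop {l} {n} l<n = begin
  holesAround p q n l + 2 * multiplesNear (p * q) {{m*n≢0 p q}} n l
    ≡⟨ cong (λ x → H + 2 * x) (multiples-around (p * q) {{m*n≢0 p q}} l<n) ⟨
  H + 2 * ∑[ i < n ] 𝟙[ p * q ∣ ∣ l - i ∣ ]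
    ≡⟨ cong (λ x → H + 2 * x) (sum-cong n (λ i → 𝟙-coprime-product cop ∣ l - i ∣)) ⟨
  H + 2 * ∑[ i < n ] (𝟙[ p ∣ ∣ l - i ∣ ] * 𝟙[ q ∣ ∣ l - i ∣ ])
    ≡⟨ cong (H +_) (sum-* n 2 _) ⟨
  H + ∑[ i < n ] (2 * (𝟙[ p ∣ ∣ l - i ∣ ] * 𝟙[ q ∣ ∣ l - i ∣ ]))
    ≡⟨ sum-+ n _ _ ⟨
  ∑[ i < n ] (holeAt p q ∣ l - i ∣ + 2 * (𝟙[ p ∣ ∣ l - i ∣ ] * 𝟙[ q ∣ ∣ l - i ∣ ]))
    ≡⟨ sum-cong n (λ i → exactlyOne-inclusion-exclusion (p ∣? ∣ l - i ∣) (q ∣? ∣ l - i ∣)) ⟩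
  ∑[ i < n ] (𝟙[ p ∣ ∣ l - i ∣ ] + 𝟙[ q ∣ ∣ l - i ∣ ])
    ≡⟨ sum-+ n _ _ ⟩
  ∑[ i < n ] 𝟙[ p ∣ ∣ l - i ∣ ] + ∑[ i < n ] 𝟙[ q ∣ ∣ l - i ∣ ]
    ≡⟨ cong₂ _+_ (multiples-around p l<n) (multiples-around q l<n) ⟩
  multiplesNear p n l + multiplesNear q n l ∎
  where
  open ≡-Reasoning
  H = holesAround p q n l

holes-lower : ∀ p q → .{{_ : NonZero p}} .{{_ : NonZero q}} → Coprime p q → ∀ {l n} → l < n →
  ⌊ n / q ⌋ + ⌊ n / p ⌋ ≤ holesAround p q n l + 2 * ⌈ n / (p * q) ⌉
holes-lower p q cop {l} {n} l<n = begin
  ⌊ n / q ⌋ + ⌊ n / p ⌋                     ≤⟨ +-mono-≤ (floor≤multiplesNear q l<n) (floor≤multiplesNear p l<n) ⟩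
  multiplesNear q n l + multiplesNear p n l ≡⟨ +-comm (multiplesNear q n l) _ ⟩
  multiplesNear p n l + multiplesNear q n l ≡⟨ holesAround-identity p q cop l<n ⟨
  H + 2 * multiplesNear (p * q) {{m*n≢0 p q}} n l
    ≤⟨ +-monoʳ-≤ H (*-monoʳ-≤ 2 (multiplesNear≤ceil (p * q) {{m*n≢0 p q}} l<n)) ⟩
  H + 2 * ⌈ n / (p * q) ⌉ ∎
  where
  open ≤-Reasoning
  H = holesAround p q n l

-- Every centre has distance 0 to itself.
multiplesNear-positive : ∀ m → .{{_ : NonZero m}} → ∀ n l → 1 ≤ multiplesNear m n l
multiplesNear-positive m n l = ≤-trans (m≤n+m 1 (l / m)) (m≤m+n (l / m + 1) _)

-- With centre q - 1, the multiples of q in distance are q - 1, 2q - 1, …: ⌊n/q⌋ of them.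
multiplesNear-period-end : ∀ q → .{{_ : NonZero q}} → ∀ {n} → q ≤ n → multiplesNear q n (q ∸ 1) ≡ ⌊ n / q ⌋
multiplesNear-period-end q@(suc k) {n} q≤n = begin
  k / q + 1 + (n ∸ q) / q    ≡⟨ cong (λ x → x + 1 + (n ∸ q) / q) (m<n⇒m/n≡0 ≤-refl) ⟩
  1 + (n ∸ q) / q            ≡⟨ m/n≡1+[m∸n]/n q≤n ⟨
  n / q ∎
  where open ≡-Reasoning

-- Upper bound at the centre q - 1: the identity with ⌊n/q⌋ multiples of q in
-- distance and at least one multiple of pq (distance 0).
holes-upper : ∀ p q → .{{_ : NonZero p}} .{{_ : NonZero q}} → Coprime p q → ∀ {n} → q ≤ n →
  holesAround p q n (q ∸ 1) + 1 ≤ ⌊ n / q ⌋ + ⌊ (n ∸ q) / p ⌋ + ⌊ (q ∸ 1) / p ⌋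
holes-upper p@(suc _) q@(suc k) cop {n} q≤n = s≤s⁻¹ (begin
  suc (H + 1)                                        ≡⟨ +-suc H 1 ⟨
  H + 2 * 1                                          ≤⟨ +-monoʳ-≤ H (*-monoʳ-≤ 2 (multiplesNear-positive (p * q) n k)) ⟩
  H + 2 * multiplesNear (p * q) n k                  ≡⟨ holesAround-identity p q cop q≤n ⟩
  multiplesNear p n k + multiplesNear q n k          ≡⟨ cong (multiplesNear p n k +_) (multiplesNear-period-end q q≤n) ⟩
  k / p + 1 + (n ∸ q) / p + n / q                    ≡⟨ regroup (k / p) ((n ∸ q) / p) (n / q) ⟩
  suc (n / q + (n ∸ q) / p + k / p) ∎)
  where
  open ≤-Reasoning
  H = holesAround p q n k
  regroup : ∀ a b c → a + 1 + b + c ≡ suc (c + b + a)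
  regroup = solve-∀

minimum-attained : ∀ {n} (f : Fin (suc n) → ℕ) → Σ (Fin (suc n)) λ l → ∀ l′ → f l ≤ f l′
minimum-attained {n} f =
  argmin f fzero (allFin (suc n)) , λ l′ → lookup (f[argmin]≤f[xs] {f = f} fzero (allFin (suc n))) (∈-allFin l′)

lemma17 : (A : Set) (a₀ b₀ : A) → a₀ ≢ b₀ →
          (p q n : ℕ) → 1 < p → p < q → Coprime p q → q ≤ n →
          Σ ℕ λ h → IsHd A n p q h
            × (⌊ n / q ⌋ + ⌊ n / p ⌋ ≤ h + 2 * ⌈ n / (p * q) ⌉)
            × (h + 1 ≤ ⌊ n / q ⌋ + ⌊ (n ∸ q) / p ⌋ + ⌊ (q ∸ 1) / p ⌋)
lemma17 A a₀ b₀ a₀≢b₀ p q zero    1<p p<q cop q≤0 = contradiction (<-≤-trans (<-trans 1<p p<q) q≤0) n≮0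
lemma17 A a₀ b₀ a₀≢b₀ p q n@(suc _) 1<p p<q cop q≤n =
  h , (p≤n , q≤n , canonical , minimal) , holes-lower p q cop (toℕ<n centre) , upper
  where
  instance
    p≢0 : NonZero p
    p≢0 = >-nonZero (<-trans z<s 1<p)
    q≢0 : NonZero q
    q≢0 = >-nonZero (<-trans z<s (<-trans 1<p p<q))
  holesAt : Fin n → ℕ
  holesAt = holesAround p q n ∘ toℕ
  best : Σ (Fin n) λ l → ∀ l′ → holesAt l ≤ holesAt l′
  best = minimum-attained holesAt
  centre : Fin n
  centre = proj₁ best
  h : ℕ
  h = holesAt centre
  p≤n : p ≤ n
  p≤n = ≤-trans (<⇒≤ p<q) q≤n
  canonical : Σ (PartialWord A n) λ S → Special p q S × holes S ≡ h
  canonical = canonicalWord p q a₀ b₀ centre , (a₀ , b₀ , a₀≢b₀ , centre , special) , special-holes p q centre _ special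
    where special = canonicalWord-special p q a₀ b₀ centre
  minimal : (S : PartialWord A n) → Special p q S → h ≤ holes S
  minimal S (_ , _ , _ , l , special) = subst (h ≤_) (sym (special-holes p q l S special)) (proj₂ best l)
  q-1<n : q ∸ 1 < n
  q-1<n = ≤-trans (m≤pred[n]⇒suc[m]≤n ≤-refl) q≤n
  h≤holes[q-1] : h ≤ holesAround p q n (q ∸ 1)
  h≤holes[q-1] = subst (h ≤_) (cong (holesAround p q n) (toℕ-fromℕ< q-1<n)) (proj₂ best (fromℕ< q-1<n))
  upper : h + 1 ≤ ⌊ n / q ⌋ + ⌊ (n ∸ q) / p ⌋ + ⌊ (q ∸ 1) / p ⌋
  upper = ≤-trans (+-monoˡ-≤ 1 h≤holes[q-1]) (holes-upper p q cop q≤n)
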